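{- Let $n\equiv 1\pmod 4$. Then for each integer $\beta$ with $0\leq \beta\leq n-5$ there exists a Heffter array $H(n;3)$, denoted $L$, with the following properties: (i) the non-empty cells of $L$ are exactly the cells of the diagonals $D_{\beta}$, $D_{\beta+2}$ and $D_{\beta+4}$; (ii) the support of $D_{\beta+2}$ in $L$ is $\{1,\dots,n\}$; (iii) the support of $D_\beta\cup D_{\beta+4}$ in $L$ is $\{n+1,\dots,3n\}$; (iv) all entries of $L$ on $D_{\beta}$ are positive; (v) all entries of $L$ on $D_{\beta+4}$ are negative; (vi) the array $M$ defined by $M(i,j)=L(i+1,j+1)$ for $i,j\in\{0,\dots,n-1\}$ (indices modulo $n$) also satisfies properties (i)–(v) and is a Heffter array $H(n;3)$.
   Context: A Heffter array $H(n;k)$ is an $n\times n$ array of integers (some cells may be empty) such that: each row and each column contains exactly $k$ filled cells; the entries in every row and every column sum to $0$ modulo $2nk+1$; and for each integer $1\leq x\leq nk$, either $x$ or $-x$ appears in the array. Rows and columns are indexed by $0,\dots,n-1$, with indices computed modulo $n$; $L(i,j)$ denotes the entry in row $i$, column $j$. For $d\in\{0,\dots,n-1\}$ the diagonal $D_d$ is the set of cells $\{(i+d \bmod n,\ i): i=0,\dots,n-1\}$. The support of a set of cells of $L$ is the set of absolute values of the entries of $L$ in those cells. -}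

module Defs where

open import Data.Nat using (ℕ; zero; suc; _+_; _*_; _≤_; NonZero)
open import Data.Nat.DivMod using (_%_; _mod_)
open import Data.Integer as ℤ using (ℤ; +_; -_; ∣_∣; _<_; _>_)
open import Data.Integer.Divisibility using (_∣_)
open import Data.Fin using (Fin; toℕ)
open import Data.List using (List; map; allFin)
open import Data.Nat.ListAction using (sum)
open import Data.Maybe using (Maybe; just; nothing; maybe)
open import Data.Product using (Σ; ∃; ∃-syntax; _×_)
open import Data.Sum using (_⊎_)
open import Relation.Binary.PropositionalEquality using (_≡_; _≢_)

-- An n × n partially filled array of integers: nothing = empty cell.
Array : ℕ → Set
Array n = Fin n → Fin n → Maybe ℤ

filled? : Maybe ℤ → ℕ
filled? = maybe (λ _ → 1) 0

val : Maybe ℤ → ℤ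
val = maybe (λ v → v) (+ 0)

sumℤ : List ℤ → ℤ
sumℤ = Data.List.foldr ℤ._+_ (+ 0)

rowCount colCount : ∀ {n} → Array n → Fin n → ℕ
rowCount {n} L r = sum (map (λ c → filled? (L r c)) (allFin n))
colCount {n} L c = sum (map (λ r → filled? (L r c)) (allFin n))

rowSum colSum : ∀ {n} → Array n → Fin n → ℤ
rowSum {n} L r = sumℤ (map (λ c → val (L r c)) (allFin n))
colSum {n} L c = sumℤ (map (λ r → val (L r c)) (allFin n))

record Heffter (n k : ℕ) (L : Array n) : Set where
  field
    rowFilled : ∀ r → rowCount L r ≡ k
    colFilled : ∀ c → colCount L c ≡ k
    rowZero   : ∀ r → (+ (2 * n * k + 1)) ∣ rowSum L r
    colZero   : ∀ c → (+ (2 * n * k + 1)) ∣ colSum L c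
    covers    : ∀ x → 1 ≤ x → x ≤ n * k →
                ∃[ r ] ∃[ c ] (L r c ≡ just (+ x) ⊎ L r c ≡ just (- (+ x)))

InDiag : ∀ {n} .{{_ : NonZero n}} → ℕ → Fin n → Fin n → Set
InDiag {n} d r c = toℕ r ≡ (toℕ c + d) % n

InSupport : ∀ {n} → Array n → (Fin n → Fin n → Set) → ℕ → Set
InSupport L S x = ∃[ r ] ∃[ c ] (S r c × ∃[ v ] (L r c ≡ just v × ∣ v ∣ ≡ x))

record Props (n β : ℕ) .{{_ : NonZero n}} (L : Array n) : Set where
  field
    p1 : ∀ r c → (L r c ≢ nothing) →
           (InDiag β r c ⊎ InDiag (β + 2) r c ⊎ InDiag (β + 4) r c)
    p1' : ∀ r c → (InDiag β r c ⊎ InDiag (β + 2) r c ⊎ InDiag (β + 4) r c) →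
           L r c ≢ nothing
    p2 : ∀ x → (InSupport L (InDiag (β + 2)) x → 1 ≤ x × x ≤ n)
             × (1 ≤ x × x ≤ n → InSupport L (InDiag (β + 2)) x)
    p3 : ∀ x → (InSupport L (λ r c → InDiag β r c ⊎ InDiag (β + 4) r c) x
                  → n + 1 ≤ x × x ≤ 3 * n)
             × (n + 1 ≤ x × x ≤ 3 * n
                  → InSupport L (λ r c → InDiag β r c ⊎ InDiag (β + 4) r c) x)
    p4 : ∀ r c v → InDiag β r c → L r c ≡ just v → v > + 0
    p5 : ∀ r c v → InDiag (β + 4) r c → L r c ≡ just v → v < + 0

shift : ∀ {n} .{{_ : NonZero n}} → Array n → Array n
shift {n} L i j = L (suc (toℕ i) mod n) (suc (toℕ j) mod n)

-- Write n = 4m + 1. Along the cycle j = 0, …, 4m (indices mod n) lay out a sequence of "large"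
-- values P j in [n + 1, 3n], one from each pair {x, 16m + 5 − x} (note 16m + 5 = (n + 1) + 3n),
-- chosen so that the cyclic differences Q j = 16m + 5 − P j − P (j + 1) are ±1, …, ±n, each once.
-- With J k = (2m + 1) k mod n, so that J (k + 2) = J k + 1, column k carries P (J k) on D_β,
-- Q (J k) on D_{β+2} and P (J k + 1) − (16m + 5) on D_{β+4}. Every column then sums to 0 in ℤ by
-- the definition of Q, and so does every row, which meets D_{β+4}, D_{β+2}, D_β in columns
-- k, k + 2, k + 4. Shifting both indices by one maps each diagonal onto itself, so the shifted
-- array carries the same kind of entries, reindexed by k ↦ k + 1.

module Submission where

open import Defs
open import Data.Nat.DivMod using (_%_)
open import Data.Product using (Σ; _×_)
open import Relation.Binary.PropositionalEquality using (_≡_)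

open import Algebra.Bundles using (CommutativeMonoid)
open import Algebra.Structures using (IsCommutativeMonoid)
import Algebra.Properties.CommutativeSemigroup as CommutativeSemigroupProperties
open import Data.Bool using (Bool; true; false; if_then_else_)
open import Data.Empty using (⊥-elim)
open import Data.Fin using (Fin; toℕ; fromℕ<) renaming (zero to fzero; suc to fsuc)
open import Data.Fin.Properties using (toℕ<n; toℕ-fromℕ<; toℕ-injective; suc-injective)
open import Data.Integer as ℤ using (ℤ; +_; -_; ∣_∣; 0ℤ)
import Data.Integer.Divisibility
import Data.Integer.Properties as ℤ
import Data.Integer.Tactic.RingSolver as ℤ-Solver
open import Data.List using (List; []; _∷_; map; allFin; tabulate; foldr)
open import Data.List.Properties using (map-tabulate; tabulate-cong)
open import Data.Maybe using (Maybe; just; nothing)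
open import Data.Maybe.Properties using (just-injective)
open import Data.Nat as ℕ using (ℕ; zero; suc; _+_; _*_; _∸_; _≤_; _<_; z≤n; s≤s; NonZero; pred; ⌊_/2⌋)
open import Data.Nat.DivMod using (_mod_; m<n⇒m%n≡m; m%n<n; m%n≤n; %-distribˡ-+; %-distribˡ-*; m%n%n≡m%n;
  [m+n]%n≡m%n; [m+kn]%n≡m%n; n%n≡0; m≡m%n+[m/n]*n; _/_)
open import Data.Nat.Divisibility using (_∣0)
open import Data.Nat.Properties hiding (suc-injective)
import Data.Nat.Tactic.RingSolver as ℕ-Solver
open import Data.Product using (∃; ∃-syntax; _,_; proj₂)
open import Data.Sum as Sum using (_⊎_; inj₁; inj₂)
open import Function using (_∘_)
open import Level using (0ℓ)
open import Relation.Binary.Definitions using (tri<; tri≈; tri>)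
open import Relation.Binary.PropositionalEquality
  using (_≢_; refl; sym; trans; cong; cong₂; subst; module ≡-Reasoning)
open import Relation.Nullary using (¬_; Dec; yes; no)
open ≡-Reasoning

InRange : ℕ → ℕ → ℕ → Set
InRange lo hi x = lo ≤ x × x ≤ hi

_≡±_ : ℤ → ℕ → Set
z ≡± x = z ≡ + x ⊎ z ≡ - + x

∣≡±∣ : ∀ {z x} → z ≡± x → ∣ z ∣ ≡ x
∣≡±∣ (inj₁ refl) = refl
∣≡±∣ {x = x} (inj₂ refl) = ℤ.∣-i∣≡∣i∣ (+ x)

-- Opaque so that Agda's injectivity analysis does not normalise the ring-solver proofs they receive.
opaque
  m+n≡o⇒m≤o : ∀ {m o} n → m + n ≡ o → m ≤ o
  m+n≡o⇒m≤o {m} n refl = m≤m+n m n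

  m+n≡o⇒o∸n≡m : ∀ {m o} n → m + n ≡ o → o ∸ n ≡ m
  m+n≡o⇒o∸n≡m {m} n refl = m+n∸n≡m m n

p+q+r≡k⇒k-p-q≡r : ∀ {k p q r} → p + q + r ≡ k → + k ℤ.- + p ℤ.- + q ≡ + r
p+q+r≡k⇒k-p-q≡r {p = p} {q} {r} refl = begin
  + (p + q + r) ℤ.- + p ℤ.- + q      ≡⟨ cong (λ w → w ℤ.- + p ℤ.- + q) (trans (ℤ.pos-+ (p + q) r) (cong (ℤ._+ + r) (ℤ.pos-+ p q))) ⟩
  + p ℤ.+ + q ℤ.+ + r ℤ.- + p ℤ.- + q ≡⟨ cancel (+ p) (+ q) (+ r) ⟩
  + r                                 ∎
  where
  cancel : ∀ x y z → x ℤ.+ y ℤ.+ z ℤ.- x ℤ.- y ≡ z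
  cancel = ℤ-Solver.solve-∀

k+r≡p+q⇒k-p-q≡-r : ∀ {k p q r} → k + r ≡ p + q → + k ℤ.- + p ℤ.- + q ≡ - + r
k+r≡p+q⇒k-p-q≡-r {k} {p} {q} {r} eq = begin
  + k ℤ.- + p ℤ.- + q        ≡⟨ regroup (+ k) (+ p) (+ q) ⟩
  + k ℤ.- (+ p ℤ.+ + q)      ≡⟨ cong (λ w → + k ℤ.- w) (sym (ℤ.pos-+ p q)) ⟩
  + k ℤ.- + (p + q)          ≡⟨ cong (λ w → + k ℤ.- + w) (sym eq) ⟩
  + k ℤ.- + (k + r)          ≡⟨ cong (λ w → + k ℤ.- w) (ℤ.pos-+ k r) ⟩
  + k ℤ.- (+ k ℤ.+ + r)      ≡⟨ cancel (+ k) (+ r) ⟩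
  - + r                      ∎
  where
  regroup : ∀ x y z → x ℤ.- y ℤ.- z ≡ x ℤ.- (y ℤ.+ z)
  regroup = ℤ-Solver.solve-∀
  cancel : ∀ x z → x ℤ.- (x ℤ.+ z) ≡ - z
  cancel = ℤ-Solver.solve-∀

p≤k⇒p-k≡-[k∸p] : ∀ {p k} → p ≤ k → + p ℤ.- + k ≡ - + (k ∸ p)
p≤k⇒p-k≡-[k∸p] {p} {k} p≤k with r , refl ← m≤n⇒∃[o]m+o≡n p≤k = begin
  + p ℤ.- + (p + r)        ≡⟨ cong (λ w → + p ℤ.- w) (ℤ.pos-+ p r) ⟩
  + p ℤ.- (+ p ℤ.+ + r)    ≡⟨ cancel (+ p) (+ r) ⟩
  - + r                    ≡⟨ cong (λ w → - + w) (m+n∸m≡n p r) ⟨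
  - + (p + r ∸ p)          ∎
  where
  cancel : ∀ x z → x ℤ.- (x ℤ.+ z) ≡ - z
  cancel = ℤ-Solver.solve-∀

module Modular (n : ℕ) .{{_ : NonZero n}} where

  [m%n+o]%n≡[m+o]%n : ∀ m o → (m % n + o) % n ≡ (m + o) % n
  [m%n+o]%n≡[m+o]%n m o = begin
    (m % n + o) % n          ≡⟨ %-distribˡ-+ (m % n) o n ⟩
    (m % n % n + o % n) % n  ≡⟨ cong (λ z → (z + o % n) % n) (m%n%n≡m%n m n) ⟩
    (m % n + o % n) % n      ≡⟨ %-distribˡ-+ m o n ⟨
    (m + o) % n              ∎

  [m+o%n]%n≡[m+o]%n : ∀ m o → (m + o % n) % n ≡ (m + o) % n
  [m+o%n]%n≡[m+o]%n m o = begin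
    (m + o % n) % n  ≡⟨ cong (_% n) (+-comm m (o % n)) ⟩
    (o % n + m) % n  ≡⟨ [m%n+o]%n≡[m+o]%n o m ⟩
    (o + m) % n      ≡⟨ cong (_% n) (+-comm o m) ⟩
    (m + o) % n      ∎

  [m%n*o]%n≡[m*o]%n : ∀ m o → (m % n * o) % n ≡ (m * o) % n
  [m%n*o]%n≡[m*o]%n m o = begin
    (m % n * o) % n              ≡⟨ %-distribˡ-* (m % n) o n ⟩
    (m % n % n * (o % n)) % n    ≡⟨ cong (λ z → (z * (o % n)) % n) (m%n%n≡m%n m n) ⟩
    (m % n * (o % n)) % n        ≡⟨ %-distribˡ-* m o n ⟨
    (m * o) % n                  ∎

  -- Adding (n ∸ 1) * o undoes the addition of o.
  %-cancelʳ-+ : ∀ m k o → (m + o) % n ≡ (k + o) % n → m % n ≡ k % n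
  %-cancelʳ-+ m k o eq = begin
    m % n                              ≡⟨ [m+kn]%n≡m%n m o n ⟨
    (m + o * n) % n                    ≡⟨ cong (_% n) (split m) ⟩
    (m + o + o * pred n) % n           ≡⟨ [m%n+o]%n≡[m+o]%n (m + o) (o * pred n) ⟨
    ((m + o) % n + o * pred n) % n     ≡⟨ cong (λ z → (z + o * pred n) % n) eq ⟩
    ((k + o) % n + o * pred n) % n     ≡⟨ [m%n+o]%n≡[m+o]%n (k + o) (o * pred n) ⟩
    (k + o + o * pred n) % n           ≡⟨ cong (_% n) (split k) ⟨
    (k + o * n) % n                    ≡⟨ [m+kn]%n≡m%n k o n ⟩
    k % n                              ∎
    where
    split : ∀ z → z + o * n ≡ z + o + o * pred n
    split z = begin
      z + o * n             ≡⟨ cong (λ w → z + o * w) (suc-pred n) ⟨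
      z + o * suc (pred n)  ≡⟨ cong (λ w → z + w) (*-suc o (pred n)) ⟩
      z + (o + o * pred n)  ≡⟨ +-assoc z o (o * pred n) ⟨
      z + o + o * pred n    ∎

  m%n≢[m+o]%n : ∀ m o → 0 < o → o < n → m % n ≢ (m + o) % n
  m%n≢[m+o]%n m o 0<o o<n eq with m % n + o ℕ.<? n
  ... | yes r+o<n = <⇒≢ (m<m+n (m % n) 0<o) (begin
        m % n              ≡⟨ eq ⟩
        (m + o) % n        ≡⟨ [m%n+o]%n≡[m+o]%n m o ⟨
        (m % n + o) % n    ≡⟨ m<n⇒m%n≡m r+o<n ⟩
        m % n + o          ∎)
  ... | no r+o≮n = <⇒≢ o<n (sym (+-cancelˡ-≡ (m % n) n o (begin
        m % n + n  ≡⟨ cong (_+ n) r≡s ⟩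
        s + n      ≡⟨ m∸n+n≡m n≤r+o ⟩
        m % n + o  ∎)))
    where
    n≤r+o : n ≤ m % n + o
    n≤r+o = ≮⇒≥ r+o≮n
    s = m % n + o ∸ n
    s<n : s < n
    s<n = +-cancelʳ-< n s n (subst (_< n + n) (sym (m∸n+n≡m n≤r+o)) (+-mono-< (m%n<n m n) o<n))
    r≡s : m % n ≡ s
    r≡s = begin
      m % n            ≡⟨ eq ⟩
      (m + o) % n      ≡⟨ [m%n+o]%n≡[m+o]%n m o ⟨
      (m % n + o) % n  ≡⟨ cong (_% n) (m∸n+n≡m n≤r+o) ⟨
      (s + n) % n      ≡⟨ [m+n]%n≡m%n s n ⟩
      s % n            ≡⟨ m<n⇒m%n≡m s<n ⟩
      s                ∎

  [1+[m+o]%n]%n≡[[1+m]%n+o]%n : ∀ m o → suc ((m + o) % n) % n ≡ (suc m % n + o) % n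
  [1+[m+o]%n]%n≡[[1+m]%n+o]%n m o = trans ([m+o%n]%n≡[m+o]%n 1 (m + o)) (sym ([m%n+o]%n≡[m+o]%n (suc m) o))

  [1+[m+n∸1]%n]%n≡m : ∀ m → m < n → suc ((m + pred n) % n) % n ≡ m
  [1+[m+n∸1]%n]%n≡m m m<n = begin
    suc ((m + pred n) % n) % n  ≡⟨ [m+o%n]%n≡[m+o]%n 1 (m + pred n) ⟩
    suc (m + pred n) % n        ≡⟨ cong (_% n) (+-suc m (pred n)) ⟨
    (m + suc (pred n)) % n      ≡⟨ cong (λ w → (m + w) % n) (suc-pred n) ⟩
    (m + n) % n                 ≡⟨ [m+n]%n≡m%n m n ⟩
    m % n                       ≡⟨ m<n⇒m%n≡m m<n ⟩
    m                           ∎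

module FiniteSums {A : Set} {_∙_ : A → A → A} {ε : A}
  (isCommutativeMonoid : IsCommutativeMonoid _≡_ _∙_ ε) where

  open IsCommutativeMonoid isCommutativeMonoid using (identityˡ; identityʳ)

  private
    commutativeMonoid : CommutativeMonoid 0ℓ 0ℓ
    commutativeMonoid = record { isCommutativeMonoid = isCommutativeMonoid }

  open CommutativeSemigroupProperties (CommutativeMonoid.commutativeSemigroup commutativeMonoid)
    using (interchange)

  total : List A → A
  total = foldr _∙_ ε

  when : {P : Set} → Dec P → A → A
  when (yes _) x = x
  when (no _)  _ = ε

  total-map-allFin : ∀ {k} (f : Fin k → A) → total (map f (allFin k)) ≡ total (tabulate f)
  total-map-allFin f = cong total (map-tabulate (λ i → i) f)

  total-tabulate-ε : ∀ {k} (f : Fin k → A) → (∀ i → f i ≡ ε) → total (tabulate f) ≡ ε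
  total-tabulate-ε {zero}  f f≡ε = refl
  total-tabulate-ε {suc k} f f≡ε = begin
    f fzero ∙ total (tabulate (f ∘ fsuc))  ≡⟨ cong₂ _∙_ (f≡ε fzero) (total-tabulate-ε (f ∘ fsuc) (f≡ε ∘ fsuc)) ⟩
    ε ∙ ε                                  ≡⟨ identityˡ ε ⟩
    ε                                      ∎

  total-tabulate-single : ∀ {k} (f : Fin k → A) p → (∀ i → i ≢ p → f i ≡ ε) → total (tabulate f) ≡ f p
  total-tabulate-single {suc k} f fzero off = begin
    f fzero ∙ total (tabulate (f ∘ fsuc))  ≡⟨ cong (f fzero ∙_) (total-tabulate-ε (f ∘ fsuc) (λ i → off (fsuc i) (λ ()))) ⟩
    f fzero ∙ ε                            ≡⟨ identityʳ (f fzero) ⟩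
    f fzero                                ∎
  total-tabulate-single {suc k} f (fsuc p) off = begin
    f fzero ∙ total (tabulate (f ∘ fsuc))  ≡⟨ cong₂ _∙_ (off fzero (λ ())) (total-tabulate-single (f ∘ fsuc) p off′) ⟩
    ε ∙ f (fsuc p)                         ≡⟨ identityˡ (f (fsuc p)) ⟩
    f (fsuc p)                             ∎
    where
    off′ : ∀ i → i ≢ p → f (fsuc i) ≡ ε
    off′ i i≢p = off (fsuc i) (i≢p ∘ suc-injective)

  total-tabulate-∙ : ∀ {k} (f g : Fin k → A) →
    total (tabulate (λ i → f i ∙ g i)) ≡ total (tabulate f) ∙ total (tabulate g)
  total-tabulate-∙ {zero}  f g = sym (identityˡ ε)
  total-tabulate-∙ {suc k} f g = begin
    (f fzero ∙ g fzero) ∙ total (tabulate (λ i → f (fsuc i) ∙ g (fsuc i)))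
      ≡⟨ cong ((f fzero ∙ g fzero) ∙_) (total-tabulate-∙ (f ∘ fsuc) (g ∘ fsuc)) ⟩
    (f fzero ∙ g fzero) ∙ (total (tabulate (f ∘ fsuc)) ∙ total (tabulate (g ∘ fsuc)))
      ≡⟨ interchange _ _ _ _ ⟩
    total (tabulate f) ∙ total (tabulate g)
      ∎

  total-tabulate-split : ∀ {k} (g x y z : Fin k → A) → (∀ i → g i ≡ (x i ∙ y i) ∙ z i) →
    total (map g (allFin k)) ≡ (total (tabulate x) ∙ total (tabulate y)) ∙ total (tabulate z)
  total-tabulate-split g x y z g≡ = begin
    total (map g (allFin _))                                ≡⟨ total-map-allFin g ⟩
    total (tabulate g)                                      ≡⟨ cong total (tabulate-cong g≡) ⟩
    total (tabulate (λ i → (x i ∙ y i) ∙ z i))              ≡⟨ total-tabulate-∙ (λ i → x i ∙ y i) z ⟩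
    total (tabulate (λ i → x i ∙ y i)) ∙ total (tabulate z) ≡⟨ cong (_∙ total (tabulate z)) (total-tabulate-∙ x y) ⟩
    (total (tabulate x) ∙ total (tabulate y)) ∙ total (tabulate z) ∎

  total-when-unique : ∀ {k} {P : Fin k → Set} (P? : ∀ i → Dec (P i)) (f : Fin k → A) p →
    P p → (∀ i → P i → i ≡ p) → total (tabulate (λ i → when (P? i) (f i))) ≡ f p
  total-when-unique {P = P} P? f p Pp unique = begin
    total (tabulate (λ i → when (P? i) (f i)))  ≡⟨ total-tabulate-single _ p off ⟩
    when (P? p) (f p)                           ≡⟨ at p Pp ⟩
    f p                                         ∎
    where
    at : ∀ i → P i → when (P? i) (f i) ≡ f i
    at i Pi with P? i
    ... | yes _   = refl
    ... | no ¬Pi = ⊥-elim (¬Pi Pi)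
    off : ∀ i → i ≢ p → when (P? i) (f i) ≡ ε
    off i i≢p with P? i
    ... | yes Pi = ⊥-elim (i≢p (unique i Pi))
    ... | no _   = refl

module Diagonals (n : ℕ) .{{_ : NonZero n}} where
  open Modular n

  diagonal? : ∀ d (i j : Fin n) → Dec (InDiag d i j)
  diagonal? d i j = toℕ i ≟ (toℕ j + d) % n

  diagonals-disjoint : ∀ d e {i j} → 0 < e → e < n → InDiag d i j → ¬ InDiag (d + e) i j
  diagonals-disjoint d e {i} {j} 0<e e<n on-d on-d+e = m%n≢[m+o]%n (toℕ j + d) e 0<e e<n (begin
    (toℕ j + d) % n        ≡⟨ on-d ⟨
    toℕ i                  ≡⟨ on-d+e ⟩
    (toℕ j + (d + e)) % n  ≡⟨ cong (_% n) (+-assoc (toℕ j) d e) ⟨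
    (toℕ j + d + e) % n    ∎)

  module Disjoint (4<n : 4 < n) (β : ℕ) (i j : Fin n) where

    β∩β+2 : InDiag β i j → ¬ InDiag (β + 2) i j
    β∩β+2 = diagonals-disjoint β 2 {i} {j} (s≤s z≤n) (<-trans (s≤s (s≤s (s≤s z≤n))) 4<n)

    β∩β+4 : InDiag β i j → ¬ InDiag (β + 4) i j
    β∩β+4 = diagonals-disjoint β 4 {i} {j} (s≤s z≤n) 4<n

    β+2∩β+4 : InDiag (β + 2) i j → ¬ InDiag (β + 4) i j
    β+2∩β+4 at-β+2 at-β+4 = diagonals-disjoint (β + 2) 2 {i} {j} (s≤s z≤n) (<-trans (s≤s (s≤s (s≤s z≤n))) 4<n)
      at-β+2 (subst (λ d → InDiag d i j) (sym (+-assoc β 2 2)) at-β+4)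

  toℕ-mod : ∀ m → toℕ (m mod n) ≡ m % n
  toℕ-mod m = toℕ-fromℕ< (m%n<n m n)

  rowOf : ℕ → Fin n → Fin n
  rowOf d j = (toℕ j + d) mod n

  InDiag-rowOf : ∀ d j → InDiag d (rowOf d j) j
  InDiag-rowOf d j = toℕ-mod (toℕ j + d)

  InDiag⇒≡rowOf : ∀ {d i j} → InDiag d i j → i ≡ rowOf d j
  InDiag⇒≡rowOf {d} {i} {j} on-d = toℕ-injective (trans on-d (sym (InDiag-rowOf d j)))

  InDiag-column-unique : ∀ {d i j j′} → InDiag d i j → InDiag d i j′ → j ≡ j′
  InDiag-column-unique {d} {i} {j} {j′} on-d on-d′ = toℕ-injective (begin
    toℕ j       ≡⟨ m<n⇒m%n≡m (toℕ<n j) ⟨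
    toℕ j % n   ≡⟨ %-cancelʳ-+ (toℕ j) (toℕ j′) d (trans (sym on-d) on-d′) ⟩
    toℕ j′ % n  ≡⟨ m<n⇒m%n≡m (toℕ<n j′) ⟩
    toℕ j′      ∎)

  columnOf : ℕ → Fin n → Fin n
  columnOf d i = (toℕ i + (n ∸ d % n)) mod n

  InDiag-columnOf : ∀ d i → InDiag d i (columnOf d i)
  InDiag-columnOf d i = sym (begin
    (toℕ (columnOf d i) + d) % n       ≡⟨ cong (λ w → (w + d) % n) (toℕ-mod (toℕ i + (n ∸ d % n))) ⟩
    ((toℕ i + (n ∸ d % n)) % n + d) % n ≡⟨ [m%n+o]%n≡[m+o]%n (toℕ i + (n ∸ d % n)) d ⟩
    (toℕ i + (n ∸ d % n) + d) % n       ≡⟨ [m+o%n]%n≡[m+o]%n (toℕ i + (n ∸ d % n)) d ⟨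
    (toℕ i + (n ∸ d % n) + d % n) % n   ≡⟨ cong (_% n) (+-assoc (toℕ i) (n ∸ d % n) (d % n)) ⟩
    (toℕ i + (n ∸ d % n + d % n)) % n   ≡⟨ cong (λ w → (toℕ i + w) % n) (m∸n+n≡m (m%n≤n d n)) ⟩
    (toℕ i + n) % n                     ≡⟨ [m+n]%n≡m%n (toℕ i) n ⟩
    toℕ i % n                           ≡⟨ m<n⇒m%n≡m (toℕ<n i) ⟩
    toℕ i                               ∎)

  InDiag-+ : ∀ d e {i j} → InDiag (d + e) i j → InDiag d i ((toℕ j + e) mod n)
  InDiag-+ d e {i} {j} on-d+e = begin
    toℕ i                             ≡⟨ on-d+e ⟩
    (toℕ j + (d + e)) % n             ≡⟨ cong (_% n) (+-comm (toℕ j) (d + e)) ⟩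
    (d + e + toℕ j) % n               ≡⟨ cong (_% n) (+-assoc d e (toℕ j)) ⟩
    (d + (e + toℕ j)) % n             ≡⟨ cong (λ w → (d + w) % n) (+-comm e (toℕ j)) ⟩
    (d + (toℕ j + e)) % n             ≡⟨ [m+o%n]%n≡[m+o]%n d (toℕ j + e) ⟨
    (d + (toℕ j + e) % n) % n         ≡⟨ cong (_% n) (+-comm d ((toℕ j + e) % n)) ⟩
    ((toℕ j + e) % n + d) % n         ≡⟨ cong (λ w → (w + d) % n) (toℕ-mod (toℕ j + e)) ⟨
    (toℕ ((toℕ j + e) mod n) + d) % n ∎

  next : Fin n → Fin n
  next i = suc (toℕ i) mod n

  InDiag-next : ∀ d {i j} → InDiag d i j → InDiag d (next i) (next j)
  InDiag-next d {i} {j} on-d = begin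
    toℕ (next i)                ≡⟨ toℕ-mod (suc (toℕ i)) ⟩
    (1 + toℕ i) % n             ≡⟨ cong (λ w → (1 + w) % n) on-d ⟩
    (1 + (toℕ j + d) % n) % n   ≡⟨ [m+o%n]%n≡[m+o]%n 1 (toℕ j + d) ⟩
    (suc (toℕ j) + d) % n       ≡⟨ [m%n+o]%n≡[m+o]%n (suc (toℕ j)) d ⟨
    (suc (toℕ j) % n + d) % n   ≡⟨ cong (λ w → (w + d) % n) (toℕ-mod (suc (toℕ j))) ⟨
    (toℕ (next j) + d) % n      ∎

  InDiag-next⁻¹ : ∀ d {i j} → InDiag d (next i) (next j) → InDiag d i j
  InDiag-next⁻¹ d {i} {j} on-d = begin
    toℕ i          ≡⟨ m<n⇒m%n≡m (toℕ<n i) ⟨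
    toℕ i % n      ≡⟨ %-cancelʳ-+ (toℕ i) (toℕ j + d) 1 (begin
       (toℕ i + 1) % n           ≡⟨ cong (_% n) (+-comm (toℕ i) 1) ⟩
       suc (toℕ i) % n           ≡⟨ toℕ-mod (suc (toℕ i)) ⟨
       toℕ (next i)              ≡⟨ on-d ⟩
       (toℕ (next j) + d) % n    ≡⟨ cong (λ w → (w + d) % n) (toℕ-mod (suc (toℕ j))) ⟩
       (suc (toℕ j) % n + d) % n ≡⟨ [m%n+o]%n≡[m+o]%n (suc (toℕ j)) d ⟩
       (suc (toℕ j) + d) % n     ≡⟨ cong (_% n) (+-comm 1 (toℕ j + d)) ⟩
       (toℕ j + d + 1) % n       ∎) ⟩
    (toℕ j + d) % n ∎

-- Column k carries a k, b k, c k on D_β, D_{β+2}, D_{β+4}; the row through the cell of c k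
-- meets D_{β+2} in column k + 2 and D_β in column k + 4.
record DiagonalEntries (n : ℕ) .{{_ : NonZero n}} : Set where
  field
    a b c      : ℕ → ℤ
    column-sum : ∀ k → k < n → a k ℤ.+ b k ℤ.+ c k ≡ 0ℤ
    row-sum    : ∀ k → k < n → a ((k + 4) % n) ℤ.+ b ((k + 2) % n) ℤ.+ c k ≡ 0ℤ
    b-range    : ∀ k → k < n → InRange 1 n ∣ b k ∣
    a-positive : ∀ k → k < n → ∃[ p ] a k ≡ + p × InRange (n + 1) (3 * n) p
    c-negative : ∀ k → k < n → ∃[ p ] c k ≡ - + p × InRange (n + 1) (3 * n) p
    b-onto     : ∀ x → InRange 1 n x → ∃[ k ] k < n × b k ≡± x
    ac-onto    : ∀ x → InRange (n + 1) (3 * n) x → ∃[ k ] k < n × (a k ≡ + x ⊎ c k ≡ - + x)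

record Carries {n : ℕ} .{{_ : NonZero n}} (β : ℕ) (E : DiagonalEntries n) (L : Array n) : Set where
  open DiagonalEntries E
  field
    on-β   : ∀ i j → InDiag β i j → L i j ≡ just (a (toℕ j))
    on-β+2 : ∀ i j → InDiag (β + 2) i j → L i j ≡ just (b (toℕ j))
    on-β+4 : ∀ i j → InDiag (β + 4) i j → L i j ≡ just (c (toℕ j))
    off    : ∀ i j → ¬ InDiag β i j → ¬ InDiag (β + 2) i j → ¬ InDiag (β + 4) i j → L i j ≡ nothing

module LineTotals {A : Set} {_∙_ : A → A → A} {ε : A}
  (isCommutativeMonoid : IsCommutativeMonoid _≡_ _∙_ ε)
  {n : ℕ} .{{_ : NonZero n}} (4<n : 4 < n) {β : ℕ} {E : DiagonalEntries n} {L : Array n}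
  (carries : Carries β E L) (f : Maybe ℤ → A) (f-nothing : f nothing ≡ ε) where

  open IsCommutativeMonoid isCommutativeMonoid using (identityˡ; identityʳ)
  open FiniteSums isCommutativeMonoid
  open Diagonals n
  open DiagonalEntries E
  open Carries carries using (on-β; on-β+2; on-β+4; off)

  fa fb fc : ℕ → A
  fa k = f (just (a k))
  fb k = f (just (b k))
  fc k = f (just (c k))

  cell : ∀ i j → f (L i j) ≡
    (when (diagonal? β i j) (fa (toℕ j)) ∙ when (diagonal? (β + 2) i j) (fb (toℕ j)))
      ∙ when (diagonal? (β + 4) i j) (fc (toℕ j))
  cell i j with diagonal? β i j | diagonal? (β + 2) i j | diagonal? (β + 4) i j
  ... | yes p | yes q | _     = ⊥-elim (Disjoint.β∩β+2 4<n β i j p q)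
  ... | yes p | no _  | yes s = ⊥-elim (Disjoint.β∩β+4 4<n β i j p s)
  ... | no _  | yes q | yes s = ⊥-elim (Disjoint.β+2∩β+4 4<n β i j q s)
  ... | yes p | no _  | no _  = begin
    f (L i j)               ≡⟨ cong f (on-β i j p) ⟩
    fa (toℕ j)              ≡⟨ identityʳ _ ⟨
    fa (toℕ j) ∙ ε          ≡⟨ identityʳ _ ⟨
    (fa (toℕ j) ∙ ε) ∙ ε    ∎
  ... | no _  | yes q | no _  = begin
    f (L i j)               ≡⟨ cong f (on-β+2 i j q) ⟩
    fb (toℕ j)              ≡⟨ identityˡ _ ⟨
    ε ∙ fb (toℕ j)          ≡⟨ identityʳ _ ⟨
    (ε ∙ fb (toℕ j)) ∙ ε    ∎
  ... | no _  | no _  | yes s = begin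
    f (L i j)               ≡⟨ cong f (on-β+4 i j s) ⟩
    fc (toℕ j)              ≡⟨ identityˡ _ ⟨
    ε ∙ fc (toℕ j)          ≡⟨ cong (_∙ fc (toℕ j)) (identityˡ ε) ⟨
    (ε ∙ ε) ∙ fc (toℕ j)    ∎
  ... | no p  | no q  | no s  = begin
    f (L i j)               ≡⟨ cong f (off i j p q s) ⟩
    f nothing               ≡⟨ f-nothing ⟩
    ε                       ≡⟨ identityˡ ε ⟨
    ε ∙ ε                   ≡⟨ cong (_∙ ε) (identityˡ ε) ⟨
    (ε ∙ ε) ∙ ε             ∎

  column-total : ∀ j → total (map (λ i → f (L i j)) (allFin n)) ≡ (fa (toℕ j) ∙ fb (toℕ j)) ∙ fc (toℕ j)
  column-total j = trans (total-tabulate-split _ _ _ _ (λ i → cell i j))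
    (cong₂ _∙_ (cong₂ _∙_ (along β fa) (along (β + 2) fb)) (along (β + 4) fc))
    where
    along : ∀ d (g : ℕ → A) → total (tabulate (λ i → when (diagonal? d i j) (g (toℕ j)))) ≡ g (toℕ j)
    along d g = total-when-unique (λ i → diagonal? d i j) (λ _ → g (toℕ j)) (rowOf d j)
      (InDiag-rowOf d j) (λ i → InDiag⇒≡rowOf {d} {i} {j})

  row-total : ∀ i → ∃[ j ] total (map (λ j → f (L i j)) (allFin n)) ≡
    (fa ((toℕ j + 4) % n) ∙ fb ((toℕ j + 2) % n)) ∙ fc (toℕ j)
  row-total i = j , trans (total-tabulate-split _ _ _ _ (cell i)) (cong₂ _∙_ (cong₂ _∙_
    (trans (along β fa at-β) (cong fa (toℕ-mod (toℕ j + 4))))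
    (trans (along (β + 2) fb at-β+2) (cong fb (toℕ-mod (toℕ j + 2)))))
    (along (β + 4) fc at-β+4))
    where
    j = columnOf (β + 4) i
    at-β+4 : InDiag (β + 4) i j
    at-β+4 = InDiag-columnOf (β + 4) i
    at-β : InDiag β i ((toℕ j + 4) mod n)
    at-β = InDiag-+ β 4 at-β+4
    at-β+2 : InDiag (β + 2) i ((toℕ j + 2) mod n)
    at-β+2 = InDiag-+ (β + 2) 2 (subst (λ d → InDiag d i j) (sym (+-assoc β 2 2)) at-β+4)
    along : ∀ d (g : ℕ → A) {j′} → InDiag d i j′ →
      total (tabulate (λ j → when (diagonal? d i j) (g (toℕ j)))) ≡ g (toℕ j′)
    along d g {j′} on-d = total-when-unique (diagonal? d i) (λ j → g (toℕ j)) j′ on-d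
      (λ j on-d′ → InDiag-column-unique on-d′ on-d)

module _ {n : ℕ} .{{_ : NonZero n}} (4<n : 4 < n) {β : ℕ} {E : DiagonalEntries n} {L : Array n}
  (carries : Carries β E L) where

  open DiagonalEntries E
  open Carries carries
  open Diagonals n

  private
    module Count = LineTotals +-0-isCommutativeMonoid 4<n carries filled? refl
    module Value = LineTotals ℤ.+-0-isCommutativeMonoid 4<n carries val refl

    entry : ∀ {d} (g : ℕ → ℤ) → (∀ i j → InDiag d i j → L i j ≡ just (g (toℕ j))) →
            ∀ {k} (k<n : k < n) → L (rowOf d (fromℕ< k<n)) (fromℕ< k<n) ≡ just (g k)
    entry {d} g on-d k<n = trans (on-d _ _ (InDiag-rowOf d _)) (cong (just ∘ g) (toℕ-fromℕ< k<n))

    value : ∀ {d} (g : ℕ → ℤ) → (∀ i j → InDiag d i j → L i j ≡ just (g (toℕ j))) →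
            ∀ {i j v} → InDiag d i j → L i j ≡ just v → v ≡ g (toℕ j)
    value g on-d {i} {j} at-d eq = just-injective (trans (sym eq) (on-d i j at-d))

    1≤large : ∀ {p} → InRange (n + 1) (3 * n) p → 1 ≤ p
    1≤large (lo , _) = ≤-trans (m≤n+m 1 n) lo

  carries⇒covers : ∀ x → 1 ≤ x → x ≤ n * 3 → ∃[ i ] ∃[ j ] (L i j ≡ just (+ x) ⊎ L i j ≡ just (- + x))
  carries⇒covers x 1≤x x≤3n with x ℕ.≤? n
  ... | yes x≤n = let (k , k<n , b≡±x) = b-onto x (1≤x , x≤n) in
    _ , _ , Sum.map (λ e → trans (entry b on-β+2 k<n) (cong just e))
                    (λ e → trans (entry b on-β+2 k<n) (cong just e)) b≡±x
  ... | no x≰n with ac-onto x (subst (_≤ x) (+-comm 1 n) (≰⇒> x≰n) , subst (x ≤_) (*-comm n 3) x≤3n)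
  ...   | k , k<n , inj₁ e = _ , _ , inj₁ (trans (entry a on-β k<n) (cong just e))
  ...   | k , k<n , inj₂ e = _ , _ , inj₂ (trans (entry c on-β+4 k<n) (cong just e))

  carries⇒heffter : Heffter n 3 L
  carries⇒heffter = record
    { rowFilled = λ i → proj₂ (Count.row-total i)
    ; colFilled = Count.column-total
    ; rowZero   = λ i → let (j , eq) = Value.row-total i in
                    zero-divisible (trans eq (row-sum (toℕ j) (toℕ<n j)))
    ; colZero   = λ j → zero-divisible (trans (Value.column-total j) (column-sum (toℕ j) (toℕ<n j)))
    ; covers    = carries⇒covers
    }
    where
    zero-divisible : ∀ {z} → z ≡ 0ℤ → + (2 * n * 3 + 1) Data.Integer.Divisibility.∣ z
    zero-divisible refl = _ ∣0

  nonempty⇒on-diagonals : ∀ i j → L i j ≢ nothing →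
    InDiag β i j ⊎ InDiag (β + 2) i j ⊎ InDiag (β + 4) i j
  nonempty⇒on-diagonals i j L≢nothing
    with diagonal? β i j | diagonal? (β + 2) i j | diagonal? (β + 4) i j
  ... | yes p | _     | _     = inj₁ p
  ... | no _  | yes q | _     = inj₂ (inj₁ q)
  ... | no _  | no _  | yes s = inj₂ (inj₂ s)
  ... | no p  | no q  | no s  = ⊥-elim (L≢nothing (off i j p q s))

  on-diagonals⇒nonempty : ∀ i j → InDiag β i j ⊎ InDiag (β + 2) i j ⊎ InDiag (β + 4) i j →
    L i j ≢ nothing
  on-diagonals⇒nonempty i j (inj₁ p)        eq with () ← trans (sym (on-β i j p)) eq
  on-diagonals⇒nonempty i j (inj₂ (inj₁ q)) eq with () ← trans (sym (on-β+2 i j q)) eq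
  on-diagonals⇒nonempty i j (inj₂ (inj₂ s)) eq with () ← trans (sym (on-β+4 i j s)) eq

  support-β+2 : ∀ x → InSupport L (InDiag (β + 2)) x → InRange 1 n x
  support-β+2 x (i , j , at-β+2 , v , eq , ∣v∣≡x) =
    subst (InRange 1 n) (trans (cong ∣_∣ (sym (value b on-β+2 at-β+2 eq))) ∣v∣≡x) (b-range (toℕ j) (toℕ<n j))

  support-β+2⁻¹ : ∀ x → InRange 1 n x → InSupport L (InDiag (β + 2)) x
  support-β+2⁻¹ x x∈ = let (k , k<n , b≡±x) = b-onto x x∈ in
    _ , _ , InDiag-rowOf (β + 2) (fromℕ< k<n) , b k , entry b on-β+2 k<n , ∣≡±∣ b≡±x

  support-β∪β+4 : ∀ x → InSupport L (λ i j → InDiag β i j ⊎ InDiag (β + 4) i j) x →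
    InRange (n + 1) (3 * n) x
  support-β∪β+4 x (i , j , inj₁ at-β , v , eq , ∣v∣≡x) =
    let (p , a≡p , p∈) = a-positive (toℕ j) (toℕ<n j) in
    subst (InRange (n + 1) (3 * n)) (trans (sym (cong ∣_∣ (trans (value a on-β at-β eq) a≡p))) ∣v∣≡x) p∈
  support-β∪β+4 x (i , j , inj₂ at-β+4 , v , eq , ∣v∣≡x) =
    let (p , c≡-p , p∈) = c-negative (toℕ j) (toℕ<n j) in
    subst (InRange (n + 1) (3 * n))
      (trans (sym (∣≡±∣ (inj₂ (trans (value c on-β+4 at-β+4 eq) c≡-p)))) ∣v∣≡x) p∈

  support-β∪β+4⁻¹ : ∀ x → InRange (n + 1) (3 * n) x →
    InSupport L (λ i j → InDiag β i j ⊎ InDiag (β + 4) i j) x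
  support-β∪β+4⁻¹ x x∈ with ac-onto x x∈
  ... | k , k<n , inj₁ e = _ , _ , inj₁ (InDiag-rowOf β (fromℕ< k<n)) , a k , entry a on-β k<n , ∣≡±∣ (inj₁ e)
  ... | k , k<n , inj₂ e = _ , _ , inj₂ (InDiag-rowOf (β + 4) (fromℕ< k<n)) , c k , entry c on-β+4 k<n , ∣≡±∣ (inj₂ e)

  0<a : ∀ k → k < n → 0ℤ ℤ.< a k
  0<a k k<n with a-positive k k<n
  ... | p , a≡p , p∈ = subst (0ℤ ℤ.<_) (sym a≡p) (ℤ.+<+ (1≤large p∈))

  c<0 : ∀ k → k < n → c k ℤ.< 0ℤ
  c<0 k k<n with c-negative k k<n
  ... | p , c≡-p , p∈ = subst (ℤ._< 0ℤ) (sym c≡-p) (negative (1≤large p∈))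
    where
    negative : ∀ {p} → 1 ≤ p → - + p ℤ.< 0ℤ
    negative {suc _} _ = ℤ.-<+

  carries⇒props : Props n β L
  carries⇒props = record
    { p1  = nonempty⇒on-diagonals
    ; p1' = on-diagonals⇒nonempty
    ; p2  = λ x → support-β+2 x , support-β+2⁻¹ x
    ; p3  = λ x → support-β∪β+4 x , support-β∪β+4⁻¹ x
    ; p4  = λ i j v at-β eq → subst (0ℤ ℤ.<_) (sym (value a on-β at-β eq)) (0<a (toℕ j) (toℕ<n j))
    ; p5  = λ i j v at-β+4 eq → subst (ℤ._< 0ℤ) (sym (value c on-β+4 at-β+4 eq)) (c<0 (toℕ j) (toℕ<n j))
    }

module _ {n : ℕ} .{{_ : NonZero n}} where

  open Modular n
  open Diagonals n

  shiftEntries : DiagonalEntries n → DiagonalEntries n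
  shiftEntries E = record
    { a          = a ∘ step
    ; b          = b ∘ step
    ; c          = c ∘ step
    ; column-sum = λ k _ → column-sum (step k) (m%n<n _ n)
    ; row-sum    = λ k _ → trans
        (cong₂ (λ u v → a u ℤ.+ b v ℤ.+ c (step k)) ([1+[m+o]%n]%n≡[[1+m]%n+o]%n k 4) ([1+[m+o]%n]%n≡[[1+m]%n+o]%n k 2))
        (row-sum (step k) (m%n<n _ n))
    ; b-range    = λ k _ → b-range (step k) (m%n<n _ n)
    ; a-positive = λ k _ → a-positive (step k) (m%n<n _ n)
    ; c-negative = λ k _ → c-negative (step k) (m%n<n _ n)
    ; b-onto     = λ x x∈ → let (k , k<n , b≡±x) = b-onto x x∈ in
        back k , m%n<n _ n , subst (λ w → b w ≡± x) (sym ([1+[m+n∸1]%n]%n≡m k k<n)) b≡±x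
    ; ac-onto    = λ x x∈ → let (k , k<n , ac≡x) = ac-onto x x∈ in
        back k , m%n<n _ n , subst (λ w → a w ≡ + x ⊎ c w ≡ - + x) (sym ([1+[m+n∸1]%n]%n≡m k k<n)) ac≡x
    }
    where
    open DiagonalEntries E
    step back : ℕ → ℕ
    step k = suc k % n
    back k = (k + pred n) % n

  carries-shift : ∀ {β E L} → Carries β E L → Carries β (shiftEntries E) (shift L)
  carries-shift {β} {E} {L} carries = record
    { on-β   = λ i j at → trans (on-β _ _ (InDiag-next β at)) (cong (just ∘ a) (toℕ-mod (suc (toℕ j))))
    ; on-β+2 = λ i j at → trans (on-β+2 _ _ (InDiag-next (β + 2) at)) (cong (just ∘ b) (toℕ-mod (suc (toℕ j))))
    ; on-β+4 = λ i j at → trans (on-β+4 _ _ (InDiag-next (β + 4) at)) (cong (just ∘ c) (toℕ-mod (suc (toℕ j))))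
    ; off    = λ i j ¬p ¬q ¬s → off _ _ (¬p ∘ InDiag-next⁻¹ β) (¬q ∘ InDiag-next⁻¹ (β + 2)) (¬s ∘ InDiag-next⁻¹ (β + 4))
    }
    where
    open DiagonalEntries E
    open Carries carries

module _ {n : ℕ} .{{_ : NonZero n}} (4<n : 4 < n) (β : ℕ) (E : DiagonalEntries n) where

  open Diagonals n
  open DiagonalEntries E

  diagonalArray : Array n
  diagonalArray i j with diagonal? β i j | diagonal? (β + 2) i j | diagonal? (β + 4) i j
  ... | yes _ | _     | _     = just (a (toℕ j))
  ... | no _  | yes _ | _     = just (b (toℕ j))
  ... | no _  | no _  | yes _ = just (c (toℕ j))
  ... | no _  | no _  | no _  = nothing

  diagonalArray-carries : Carries β E diagonalArray
  diagonalArray-carries = record { on-β = on-β ; on-β+2 = on-β+2 ; on-β+4 = on-β+4 ; off = off }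
    where
    on-β : ∀ i j → InDiag β i j → diagonalArray i j ≡ just (a (toℕ j))
    on-β i j p with diagonal? β i j
    ... | yes _ = refl
    ... | no ¬p = ⊥-elim (¬p p)

    on-β+2 : ∀ i j → InDiag (β + 2) i j → diagonalArray i j ≡ just (b (toℕ j))
    on-β+2 i j q with diagonal? β i j | diagonal? (β + 2) i j
    ... | yes p | _     = ⊥-elim (Disjoint.β∩β+2 4<n β i j p q)
    ... | no _  | yes _ = refl
    ... | no _  | no ¬q = ⊥-elim (¬q q)

    on-β+4 : ∀ i j → InDiag (β + 4) i j → diagonalArray i j ≡ just (c (toℕ j))
    on-β+4 i j s with diagonal? β i j | diagonal? (β + 2) i j | diagonal? (β + 4) i j
    ... | yes p | _     | _     = ⊥-elim (Disjoint.β∩β+4 4<n β i j p s)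
    ... | no _  | yes q | _     = ⊥-elim (Disjoint.β+2∩β+4 4<n β i j q s)
    ... | no _  | no _  | yes _ = refl
    ... | no _  | no _  | no ¬s = ⊥-elim (¬s s)

    off : ∀ i j → ¬ InDiag β i j → ¬ InDiag (β + 2) i j → ¬ InDiag (β + 4) i j → diagonalArray i j ≡ nothing
    off i j ¬p ¬q ¬s with diagonal? β i j | diagonal? (β + 2) i j | diagonal? (β + 4) i j
    ... | yes p | _     | _     = ⊥-elim (¬p p)
    ... | no _  | yes q | _     = ⊥-elim (¬q q)
    ... | no _  | no _  | yes s = ⊥-elim (¬s s)
    ... | no _  | no _  | no _  = refl

  diagonalArray-heffter : Heffter n 3 diagonalArray × Props n β diagonalArray
    × Heffter n 3 (shift diagonalArray) × Props n β (shift diagonalArray)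
  diagonalArray-heffter =
    carries⇒heffter 4<n diagonalArray-carries , carries⇒props 4<n diagonalArray-carries ,
    carries⇒heffter 4<n (carries-shift diagonalArray-carries) ,
    carries⇒props 4<n (carries-shift diagonalArray-carries)

odd : ℕ → Bool
odd zero          = false
odd (suc zero)    = true
odd (suc (suc j)) = odd j

evenEntry oddEntry : ℕ → ℕ → ℕ
evenEntry m k with k ℕ.<? m
... | yes _ = m * 9 + 3 + k
... | no _  = m * 13 + 3 ∸ k
oddEntry m k with k ℕ.<? m
... | yes _ = m * 5 + 3 + k
... | no _  = m * 9 + 2 ∸ k

large : ℕ → ℕ → ℕ
large m j = if odd j then oddEntry m ⌊ j /2⌋ else evenEntry m ⌊ j /2⌋

small : ℕ → ℕ → ℤ
small m j = + (m * 16 + 5) ℤ.- + large m j ℤ.- + large m (suc j ℕ.% suc (m * 4))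

large-even : ∀ m k → large m (k * 2) ≡ evenEntry m k
large-even m k = cong₂ (λ b h → if b then oddEntry m h else evenEntry m h) (odd-even k) (half-even k)
  where
  odd-even : ∀ k → odd (k * 2) ≡ false
  odd-even zero    = refl
  odd-even (suc k) = odd-even k
  half-even : ∀ k → ⌊ k * 2 /2⌋ ≡ k
  half-even zero    = refl
  half-even (suc k) = cong suc (half-even k)

large-odd : ∀ m k → large m (suc (k * 2)) ≡ oddEntry m k
large-odd m k = cong₂ (λ b h → if b then oddEntry m h else evenEntry m h) (odd-odd k) (half-odd k)
  where
  odd-odd : ∀ k → odd (suc (k * 2)) ≡ true
  odd-odd zero    = refl
  odd-odd (suc k) = odd-odd k
  half-odd : ∀ k → ⌊ suc (k * 2) /2⌋ ≡ k
  half-odd zero    = refl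
  half-odd (suc k) = cong suc (half-odd k)

evenEntry-< : ∀ {m k} → k < m → evenEntry m k ≡ m * 9 + 3 + k
evenEntry-< {m} {k} k<m with k ℕ.<? m
... | yes _   = refl
... | no k≮m = ⊥-elim (k≮m k<m)

evenEntry-≮ : ∀ {m k} → ¬ k < m → evenEntry m k ≡ m * 13 + 3 ∸ k
evenEntry-≮ {m} {k} k≮m with k ℕ.<? m
... | yes k<m = ⊥-elim (k≮m k<m)
... | no _    = refl

oddEntry-< : ∀ {m k} → k < m → oddEntry m k ≡ m * 5 + 3 + k
oddEntry-< {m} {k} k<m with k ℕ.<? m
... | yes _   = refl
... | no k≮m = ⊥-elim (k≮m k<m)

oddEntry-≮ : ∀ {m k} → ¬ k < m → oddEntry m k ≡ m * 9 + 2 ∸ k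
oddEntry-≮ {m} {k} k≮m with k ℕ.<? m
... | yes k<m = ⊥-elim (k≮m k<m)
... | no _    = refl

-- The six runs of positions j < 4m + 1 on which both large m j and large m (j + 1) follow one
-- formula; the index equation expresses m through the offsets, so each case is a semiring identity.
data Position (m : ℕ) : ℕ → Set where
  evenLow  : ∀ k d → suc (k + d) ≡ m → Position m (k * 2)
  evenHigh : ∀ e f → suc (e + f) ≡ m → Position m ((m + e) * 2)
  evenLast : ∀ m′ → suc m′ ≡ m → Position m ((m + m) * 2)
  oddLow   : ∀ k d → suc (suc (k + d)) ≡ m → Position m (suc (k * 2))
  oddMid   : ∀ k → suc k ≡ m → Position m (suc (k * 2))
  oddHigh  : ∀ e f → suc (e + f) ≡ m → Position m (suc ((m + e) * 2))

Position⇒< : ∀ {m j} → Position m j → j < suc (m * 4)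
Position⇒< (evenLow k d refl)  = m+n≡o⇒m≤o (k * 2 + d * 4 + 4) (ℕ-Solver.solve (k ∷ d ∷ []))
Position⇒< (evenHigh e f refl) = m+n≡o⇒m≤o (f * 2 + 2) (ℕ-Solver.solve (e ∷ f ∷ []))
Position⇒< (evenLast m refl)   = m+n≡o⇒m≤o 0 (ℕ-Solver.solve (m ∷ []))
Position⇒< (oddLow k d refl)   = m+n≡o⇒m≤o (k * 2 + d * 4 + 7) (ℕ-Solver.solve (k ∷ d ∷ []))
Position⇒< (oddMid k refl)     = m+n≡o⇒m≤o (k * 2 + 3) (ℕ-Solver.solve (k ∷ []))
Position⇒< (oddHigh e f refl)  = m+n≡o⇒m≤o (f * 2 + 1) (ℕ-Solver.solve (e ∷ f ∷ []))

largeAt : ∀ {m j} → Position m j → ℕ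
largeAt {m} (evenLow k d _)  = m * 9 + 3 + k
largeAt     (evenHigh e f _) = e * 11 + f * 12 + 15
largeAt {m} (evenLast _ _)   = m * 11 + 3
largeAt {m} (oddLow k d _)   = m * 5 + 3 + k
largeAt {m} (oddMid k _)     = m * 5 + 3 + k
largeAt     (oddHigh e f _)  = e * 7 + f * 8 + 10

large≡largeAt : ∀ {m j} (p : Position m j) → large m j ≡ largeAt p
large≡largeAt (evenLow k d refl) = trans (large-even (suc (k + d)) k) (evenEntry-< (s≤s (m≤m+n k d)))
large≡largeAt (evenHigh e f refl) = trans (large-even (suc (e + f)) (suc (e + f) + e))
  (trans (evenEntry-≮ (≤⇒≯ (m≤m+n (suc (e + f)) e))) (m+n≡o⇒o∸n≡m (suc (e + f) + e) (identity e f)))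
  where
  identity : ∀ e f → e * 11 + f * 12 + 15 + (suc (e + f) + e) ≡ suc (e + f) * 13 + 3
  identity = ℕ-Solver.solve-∀
large≡largeAt (evenLast m refl) = trans (large-even (suc m) (suc m + suc m))
  (trans (evenEntry-≮ (≤⇒≯ (m≤m+n (suc m) (suc m)))) (m+n≡o⇒o∸n≡m (suc m + suc m) (identity m)))
  where
  identity : ∀ m → suc m * 11 + 3 + (suc m + suc m) ≡ suc m * 13 + 3
  identity = ℕ-Solver.solve-∀
large≡largeAt (oddLow k d refl) = trans (large-odd (suc (suc (k + d))) k) (oddEntry-< (s≤s (≤-trans (m≤m+n k d) (n≤1+n _))))
large≡largeAt (oddMid k refl) = trans (large-odd (suc k) k) (oddEntry-< {suc k} ≤-refl)
large≡largeAt (oddHigh e f refl) = trans (large-odd (suc (e + f)) (suc (e + f) + e))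
  (trans (oddEntry-≮ (≤⇒≯ (m≤m+n (suc (e + f)) e))) (m+n≡o⇒o∸n≡m (suc (e + f) + e) (identity e f)))
  where
  identity : ∀ e f → e * 7 + f * 8 + 10 + (suc (e + f) + e) ≡ suc (e + f) * 9 + 2
  identity = ℕ-Solver.solve-∀

largeAt-range : ∀ {m j} (p : Position m j) → InRange (suc (m * 4) + 1) (3 * suc (m * 4)) (largeAt p)
largeAt-range (evenLow k d refl) = m+n≡o⇒m≤o _ (lower k d) , m+n≡o⇒m≤o _ (upper k d)
  where
  lower : ∀ k d → suc (suc (k + d) * 4) + 1 + (k * 6 + d * 5 + 6) ≡ suc (k + d) * 9 + 3 + k
  lower = ℕ-Solver.solve-∀
  upper : ∀ k d → suc (k + d) * 9 + 3 + k + (k * 2 + d * 3 + 3) ≡ 3 * suc (suc (k + d) * 4)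
  upper = ℕ-Solver.solve-∀
largeAt-range (evenHigh e f refl) = m+n≡o⇒m≤o _ (lower e f) , m+n≡o⇒m≤o _ (upper e f)
  where
  lower : ∀ e f → suc (suc (e + f) * 4) + 1 + (e * 7 + f * 8 + 9) ≡ e * 11 + f * 12 + 15
  lower = ℕ-Solver.solve-∀
  upper : ∀ e f → e * 11 + f * 12 + 15 + e ≡ 3 * suc (suc (e + f) * 4)
  upper = ℕ-Solver.solve-∀
largeAt-range (evenLast m refl) = m+n≡o⇒m≤o _ (lower m) , m+n≡o⇒m≤o _ (upper m)
  where
  lower : ∀ m → suc (suc m * 4) + 1 + (m * 7 + 8) ≡ suc m * 11 + 3
  lower = ℕ-Solver.solve-∀
  upper : ∀ m → suc m * 11 + 3 + suc m ≡ 3 * suc (suc m * 4)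
  upper = ℕ-Solver.solve-∀
largeAt-range (oddLow k d refl) = m+n≡o⇒m≤o _ (lower k d) , m+n≡o⇒m≤o _ (upper k d)
  where
  lower : ∀ k d → suc (suc (suc (k + d)) * 4) + 1 + (k * 2 + d + 3) ≡ suc (suc (k + d)) * 5 + 3 + k
  lower = ℕ-Solver.solve-∀
  upper : ∀ k d → suc (suc (k + d)) * 5 + 3 + k + (k * 6 + d * 7 + 14) ≡ 3 * suc (suc (suc (k + d)) * 4)
  upper = ℕ-Solver.solve-∀
largeAt-range (oddMid k refl) = m+n≡o⇒m≤o _ (lower k) , m+n≡o⇒m≤o _ (upper k)
  where
  lower : ∀ k → suc (suc k * 4) + 1 + (k * 2 + 2) ≡ suc k * 5 + 3 + k
  lower = ℕ-Solver.solve-∀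
  upper : ∀ k → suc k * 5 + 3 + k + (k * 6 + 7) ≡ 3 * suc (suc k * 4)
  upper = ℕ-Solver.solve-∀
largeAt-range (oddHigh e f refl) = m+n≡o⇒m≤o _ (lower e f) , m+n≡o⇒m≤o _ (upper e f)
  where
  lower : ∀ e f → suc (suc (e + f) * 4) + 1 + (e * 3 + f * 4 + 4) ≡ e * 7 + f * 8 + 10
  lower = ℕ-Solver.solve-∀
  upper : ∀ e f → e * 7 + f * 8 + 10 + (e * 5 + f * 4 + 5) ≡ 3 * suc (suc (e + f) * 4)
  upper = ℕ-Solver.solve-∀

smallAt : ∀ {m j} → Position m j → ℕ
smallAt     (evenLow k d _)  = suc (d * 2)
smallAt     (evenHigh e f _) = e * 2 + f * 4 + 4
smallAt {m} (evenLast _ _)   = suc (m * 4)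
smallAt     (oddLow k d _)   = suc (suc (d * 2))
smallAt     (oddMid k _)     = suc k * 2
smallAt     (oddHigh e f _)  = e * 2 + f * 4 + 3

small-positive : ∀ {m j q r} (p : Position m j) → large m (suc j ℕ.% suc (m * 4)) ≡ q →
  largeAt p + q + r ≡ m * 16 + 5 → small m j ≡± r
small-positive {m} {j} {q} pos next sum = inj₁ (trans
  (cong₂ (λ u v → + (m * 16 + 5) ℤ.- + u ℤ.- + v) (large≡largeAt pos) next) (p+q+r≡k⇒k-p-q≡r {p = largeAt pos} {q} sum))

small-negative : ∀ {m j q r} (p : Position m j) → large m (suc j ℕ.% suc (m * 4)) ≡ q →
  m * 16 + 5 + r ≡ largeAt p + q → small m j ≡± r
small-negative {m} {j} {q} pos next sum = inj₂ (trans
  (cong₂ (λ u v → + (m * 16 + 5) ℤ.- + u ℤ.- + v) (large≡largeAt pos) next) (k+r≡p+q⇒k-p-q≡-r {p = largeAt pos} {q} sum))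

large-next : ∀ {m j q} → suc j < suc (m * 4) → large m (suc j) ≡ q → large m (suc j ℕ.% suc (m * 4)) ≡ q
large-next {m} j+1<n eq = trans (cong (large m) (m<n⇒m%n≡m j+1<n)) eq

small≡±smallAt : ∀ {m j} (p : Position m j) → small m j ≡± smallAt p
small≡±smallAt p@(evenLow k d refl) = small-positive p
  (large-next {suc (k + d)} {k * 2} (m+n≡o⇒m≤o _ (bound k d)) (trans (large-odd (suc (k + d)) k) (oddEntry-< (s≤s (m≤m+n k d))))) (sum k d)
  where
  bound : ∀ k d → suc (suc (k * 2)) + (k * 2 + d * 4 + 3) ≡ suc (suc (k + d) * 4)
  bound = ℕ-Solver.solve-∀
  sum : ∀ k d → suc (k + d) * 9 + 3 + k + (suc (k + d) * 5 + 3 + k) + suc (d * 2) ≡ suc (k + d) * 16 + 5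
  sum = ℕ-Solver.solve-∀
small≡±smallAt p@(evenHigh e f refl) = small-negative p
  (large-next {suc (e + f)} {(suc (e + f) + e) * 2} (Position⇒< (oddHigh e f refl)) (large≡largeAt (oddHigh e f refl))) (sum e f)
  where
  sum : ∀ e f → suc (e + f) * 16 + 5 + (e * 2 + f * 4 + 4) ≡ e * 11 + f * 12 + 15 + (e * 7 + f * 8 + 10)
  sum = ℕ-Solver.solve-∀
small≡±smallAt p@(evenLast m refl) = small-negative p
  (trans (cong (large (suc m)) (trans (cong (ℕ._% suc (suc m * 4)) (wrap m)) (n%n≡0 (suc (suc m * 4)))))
         (trans (large-even (suc m) 0) (evenEntry-< {suc m} {0} (s≤s z≤n))))
  (sum m)
  where
  wrap : ∀ m → suc ((suc m + suc m) * 2) ≡ suc (suc m * 4)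
  wrap = ℕ-Solver.solve-∀
  sum : ∀ m → suc m * 16 + 5 + suc (suc m * 4) ≡ suc m * 11 + 3 + (suc m * 9 + 3 + 0)
  sum = ℕ-Solver.solve-∀
small≡±smallAt p@(oddLow k d refl) = small-positive p
  (large-next {suc (suc (k + d))} {suc (k * 2)} (m+n≡o⇒m≤o _ (bound k d)) (trans (large-even (suc (suc (k + d))) (suc k)) (evenEntry-< (s≤s (s≤s (m≤m+n k d)))))) (sum k d)
  where
  bound : ∀ k d → suc (suc (suc (k * 2))) + (k * 2 + d * 4 + 6) ≡ suc (suc (suc (k + d)) * 4)
  bound = ℕ-Solver.solve-∀
  sum : ∀ k d → suc (suc (k + d)) * 5 + 3 + k + (suc (suc (k + d)) * 9 + 3 + suc k) + suc (suc (d * 2))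
                ≡ suc (suc (k + d)) * 16 + 5
  sum = ℕ-Solver.solve-∀
small≡±smallAt p@(oddMid k refl) = small-negative p
  (large-next {suc k} {suc (k * 2)} (m+n≡o⇒m≤o _ (bound k))
    (trans (large-even (suc k) (suc k)) (trans (evenEntry-≮ {suc k} (n≮n (suc k))) (m+n≡o⇒o∸n≡m (suc k) (value k)))))
  (sum k)
  where
  bound : ∀ k → suc (suc (suc (k * 2))) + (k * 2 + 2) ≡ suc (suc k * 4)
  bound = ℕ-Solver.solve-∀
  value : ∀ k → suc k * 12 + 3 + suc k ≡ suc k * 13 + 3
  value = ℕ-Solver.solve-∀
  sum : ∀ k → suc k * 16 + 5 + suc k * 2 ≡ suc k * 5 + 3 + k + (suc k * 12 + 3)
  sum = ℕ-Solver.solve-∀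
small≡±smallAt p@(oddHigh e f refl) = small-negative p
  (large-next {suc (e + f)} {suc ((suc (e + f) + e) * 2)} (m+n≡o⇒m≤o _ (bound e f))
    (trans (large-even (suc (e + f)) (suc (suc (e + f) + e)))
      (trans (evenEntry-≮ {suc (e + f)} (≤⇒≯ (≤-trans (m≤m+n (suc (e + f)) e) (n≤1+n _))))
        (m+n≡o⇒o∸n≡m (suc (suc (e + f) + e)) (value e f)))))
  (sum e f)
  where
  bound : ∀ e f → suc (suc (suc ((suc (e + f) + e) * 2))) + f * 2 ≡ suc (suc (e + f) * 4)
  bound = ℕ-Solver.solve-∀
  value : ∀ e f → e * 11 + f * 12 + 14 + suc (suc (e + f) + e) ≡ suc (e + f) * 13 + 3
  value = ℕ-Solver.solve-∀
  sum : ∀ e f → suc (e + f) * 16 + 5 + (e * 2 + f * 4 + 3) ≡ e * 7 + f * 8 + 10 + (e * 11 + f * 12 + 14)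
  sum = ℕ-Solver.solve-∀

smallAt-range : ∀ {m j} (p : Position m j) → InRange 1 (suc (m * 4)) (smallAt p)
smallAt-range (evenLow k d refl) = s≤s z≤n , m+n≡o⇒m≤o _ (upper k d)
  where
  upper : ∀ k d → suc (d * 2) + (k * 4 + d * 2 + 4) ≡ suc (suc (k + d) * 4)
  upper = ℕ-Solver.solve-∀
smallAt-range (evenHigh e f refl) = ≤-trans (s≤s z≤n) (m≤n+m 4 _) , m+n≡o⇒m≤o _ (upper e f)
  where
  upper : ∀ e f → e * 2 + f * 4 + 4 + (e * 2 + 1) ≡ suc (suc (e + f) * 4)
  upper = ℕ-Solver.solve-∀
smallAt-range (evenLast m refl) = s≤s z≤n , ≤-refl
smallAt-range (oddLow k d refl) = s≤s z≤n , m+n≡o⇒m≤o _ (upper k d)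
  where
  upper : ∀ k d → suc (suc (d * 2)) + (k * 4 + d * 2 + 7) ≡ suc (suc (suc (k + d)) * 4)
  upper = ℕ-Solver.solve-∀
smallAt-range (oddMid k refl) = s≤s z≤n , m+n≡o⇒m≤o _ (upper k)
  where
  upper : ∀ k → suc k * 2 + (k * 2 + 3) ≡ suc (suc k * 4)
  upper = ℕ-Solver.solve-∀
smallAt-range (oddHigh e f refl) = ≤-trans (s≤s z≤n) (m≤n+m 3 _) , m+n≡o⇒m≤o _ (upper e f)
  where
  upper : ∀ e f → e * 2 + f * 4 + 3 + (e * 2 + 2) ≡ suc (suc (e + f) * 4)
  upper = ℕ-Solver.solve-∀

parity : ∀ j → ∃[ k ] (j ≡ k * 2 ⊎ j ≡ suc (k * 2))
parity zero          = 0 , inj₁ refl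
parity (suc zero)    = 0 , inj₂ refl
parity (suc (suc j)) with parity j
... | k , inj₁ refl = suc k , inj₁ refl
... | k , inj₂ refl = suc k , inj₂ refl

position : ∀ {m j} → 0 < m → j < suc (m * 4) → Position m j
position {m} {j} 0<m j<n with parity j
... | k , inj₁ refl = evenPosition k j<n
  where
  evenPosition : ∀ k → k * 2 < suc (m * 4) → Position m (k * 2)
  evenPosition k j<n with k ℕ.<? m
  ... | yes k<m = let (d , eq) = m≤n⇒∃[o]m+o≡n k<m in evenLow k d eq
  ... | no k≮m with e , refl ← m≤n⇒∃[o]m+o≡n (≮⇒≥ k≮m) with ℕ.<-cmp e m
  ...   | tri< e<m _ _ = let (f , eq) = m≤n⇒∃[o]m+o≡n e<m in evenHigh e f eq
  ...   | tri≈ _ refl _ = let (m′ , eq) = m≤n⇒∃[o]m+o≡n 0<m in evenLast m′ eq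
  ...   | tri> _ _ m<e with g , refl ← m≤n⇒∃[o]m+o≡n m<e = ⊥-elim (<⇒≱ (m+n≡o⇒m≤o _ (beyond m g)) (≤-pred j<n))
    where
    beyond : ∀ m g → suc (m * 4) + suc (g * 2) ≡ (m + suc (m + g)) * 2
    beyond = ℕ-Solver.solve-∀
... | k , inj₂ refl = oddPosition k j<n
  where
  oddPosition : ∀ k → suc (k * 2) < suc (m * 4) → Position m (suc (k * 2))
  oddPosition k j<n with ℕ.<-cmp (suc k) m
  ... | tri< k+1<m _ _ = let (d , eq) = m≤n⇒∃[o]m+o≡n k+1<m in oddLow k d eq
  ... | tri≈ _ k+1≡m _ = oddMid k k+1≡m
  ... | tri> _ _ m<k+1 with e , refl ← m≤n⇒∃[o]m+o≡n (≤-pred m<k+1) with e ℕ.<? m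
  ...   | yes e<m = let (f , eq) = m≤n⇒∃[o]m+o≡n e<m in oddHigh e f eq
  ...   | no e≮m with g , refl ← m≤n⇒∃[o]m+o≡n (≮⇒≥ e≮m) = ⊥-elim (<⇒≱ (m+n≡o⇒m≤o _ (beyond m g)) (≤-pred j<n))
    where
    beyond : ∀ m g → suc (m * 4) + g * 2 ≡ suc ((m + (m + g)) * 2)
    beyond = ℕ-Solver.solve-∀

smallAt-onto : ∀ {m x} → 0 < m → InRange 1 (suc (m * 4)) x → ∃[ j ] Σ (Position m j) (λ p → smallAt p ≡ x)
smallAt-onto {m} {suc x} 0<m (_ , x≤n) with parity x
... | y , inj₁ refl with y ℕ.<? m
...   | yes y<m = let (k , eq) = m≤n⇒∃[o]m+o≡n y<m in _ , evenLow k y (trans (cong suc (+-comm k y)) eq) , refl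
...   | no y≮m with f , refl ← m≤n⇒∃[o]m+o≡n (≮⇒≥ y≮m) with ℕ.<-cmp f m
...     | tri< f<m _ _ with e , refl ← m≤n⇒∃[o]m+o≡n f<m = _ , oddHigh e f (cong suc (+-comm e f)) , value e f
  where
  value : ∀ e f → e * 2 + f * 4 + 3 ≡ suc ((suc (f + e) + f) * 2)
  value = ℕ-Solver.solve-∀
...     | tri≈ _ refl _ = let (m′ , eq) = m≤n⇒∃[o]m+o≡n 0<m in _ , evenLast m′ eq , value m
  where
  value : ∀ m → suc (m * 4) ≡ suc ((m + m) * 2)
  value = ℕ-Solver.solve-∀
...     | tri> _ _ m<f with g , refl ← m≤n⇒∃[o]m+o≡n m<f = ⊥-elim (<⇒≱ (m+n≡o⇒m≤o _ (beyond m g)) x≤n)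
  where
  beyond : ∀ m g → suc (suc (m * 4)) + suc (g * 2) ≡ suc ((m + suc (m + g)) * 2)
  beyond = ℕ-Solver.solve-∀
smallAt-onto {m} {suc x} 0<m (_ , x≤n) | y , inj₂ refl with ℕ.<-cmp (suc y) m
... | tri< y+1<m _ _ = let (k , eq) = m≤n⇒∃[o]m+o≡n y+1<m in
  _ , oddLow k y (trans (cong (suc ∘ suc) (+-comm k y)) eq) , refl
... | tri≈ _ y+1≡m _ = _ , oddMid y y+1≡m , refl
... | tri> _ _ m<y+1 with f , refl ← m≤n⇒∃[o]m+o≡n (≤-pred m<y+1) with f ℕ.<? m
...   | yes f<m with e , refl ← m≤n⇒∃[o]m+o≡n f<m = _ , evenHigh e f (cong suc (+-comm e f)) , value e f
  where
  value : ∀ e f → e * 2 + f * 4 + 4 ≡ suc (suc ((suc (f + e) + f) * 2))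
  value = ℕ-Solver.solve-∀
...   | no f≮m with g , refl ← m≤n⇒∃[o]m+o≡n (≮⇒≥ f≮m) = ⊥-elim (<⇒≱ (m+n≡o⇒m≤o _ (beyond m g)) x≤n)
  where
  beyond : ∀ m g → suc (suc (m * 4)) + g * 2 ≡ suc (suc ((m + (m + g)) * 2))
  beyond = ℕ-Solver.solve-∀

large-range : ∀ {m j} → 0 < m → j < suc (m * 4) → InRange (suc (m * 4) + 1) (3 * suc (m * 4)) (large m j)
large-range 0<m j<n = let p = position 0<m j<n in
  subst (InRange _ _) (sym (large≡largeAt p)) (largeAt-range p)

3n≤16m+5 : ∀ m → 3 * suc (m * 4) ≤ m * 16 + 5
3n≤16m+5 m = m+n≡o⇒m≤o (m * 4 + 2) (identity m)
  where
  identity : ∀ m → 3 * suc (m * 4) + (m * 4 + 2) ≡ m * 16 + 5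
  identity = ℕ-Solver.solve-∀

∸-range : ∀ m {p} → InRange (suc (m * 4) + 1) (3 * suc (m * 4)) p →
  InRange (suc (m * 4) + 1) (3 * suc (m * 4)) (m * 16 + 5 ∸ p)
∸-range m (lo , hi) =
  ≤-trans (≤-reflexive (sym (m+n≡o⇒o∸n≡m _ (identity m)))) (∸-monoʳ-≤ (m * 16 + 5) hi) ,
  ≤-trans (∸-monoʳ-≤ (m * 16 + 5) lo) (≤-reflexive (m+n≡o⇒o∸n≡m _ (identity′ m)))
  where
  identity : ∀ m → suc (m * 4) + 1 + 3 * suc (m * 4) ≡ m * 16 + 5
  identity = ℕ-Solver.solve-∀
  identity′ : ∀ m → 3 * suc (m * 4) + (suc (m * 4) + 1) ≡ m * 16 + 5
  identity′ = ℕ-Solver.solve-∀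

LargeOrPaired : ℕ → ℕ → Set
LargeOrPaired m x = ∃[ j ] j < suc (m * 4) × (large m j ≡ x ⊎ m * 16 + 5 ∸ large m j ≡ x)

large-onto-upper : ∀ {m x} → m * 8 + 3 ≤ x → x ≤ 3 * suc (m * 4) → LargeOrPaired m x
large-onto-upper {m} lo hi with z , refl ← m≤n⇒∃[o]m+o≡n lo with z ℕ.<? m
... | yes z<m with f , refl ← m≤n⇒∃[o]m+o≡n z<m = let p = oddHigh z f refl in
  _ , Position⇒< p , inj₂ (trans (cong (suc (z + f) * 16 + 5 ∸_) (large≡largeAt p)) (m+n≡o⇒o∸n≡m _ (identity z f)))
  where
  identity : ∀ z f → suc (z + f) * 8 + 3 + z + (z * 7 + f * 8 + 10) ≡ suc (z + f) * 16 + 5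
  identity = ℕ-Solver.solve-∀
... | no z≮m with z₁ , refl ← m≤n⇒∃[o]m+o≡n (≮⇒≥ z≮m) with z₁ ℕ.<? m
...   | yes z₁<m with d , refl ← m≤n⇒∃[o]m+o≡n z₁<m = let p = evenLow z₁ d refl in
  _ , Position⇒< p , inj₁ (trans (large≡largeAt p) (identity z₁ d))
  where
  identity : ∀ z d → suc (z + d) * 9 + 3 + z ≡ suc (z + d) * 8 + 3 + (suc (z + d) + z)
  identity = ℕ-Solver.solve-∀
...   | no z₁≮m with z₂ , refl ← m≤n⇒∃[o]m+o≡n (≮⇒≥ z₁≮m) with z₂ ℕ.<? m
...     | yes z₂<m with k , refl ← m≤n⇒∃[o]m+o≡n z₂<m =
  suc (k * 2) , m+n≡o⇒m≤o _ (bound z₂ k) ,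
  inj₂ (trans (cong (suc (z₂ + k) * 16 + 5 ∸_) (trans (large-odd (suc (z₂ + k)) k) (oddEntry-< (s≤s (m≤n+m k z₂))))) (m+n≡o⇒o∸n≡m _ (identity z₂ k)))
  where
  bound : ∀ z k → suc (suc (k * 2)) + (z * 4 + k * 2 + 3) ≡ suc (suc (z + k) * 4)
  bound = ℕ-Solver.solve-∀
  identity : ∀ z k → suc (z + k) * 8 + 3 + (suc (z + k) + (suc (z + k) + z)) + (suc (z + k) * 5 + 3 + k)
                     ≡ suc (z + k) * 16 + 5
  identity = ℕ-Solver.solve-∀
...     | no z₂≮m with z₃ , refl ← m≤n⇒∃[o]m+o≡n (≮⇒≥ z₂≮m) with z₃ ℕ.≤? m
...       | yes z₃≤m with v , refl ← m≤n⇒∃[o]m+o≡n z₃≤m =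
  (z₃ + v + v) * 2 , m+n≡o⇒m≤o _ (bound z₃ v) ,
  inj₁ (trans (large-even (z₃ + v) (z₃ + v + v)) (trans (evenEntry-≮ (≤⇒≯ (m≤m+n (z₃ + v) v))) (m+n≡o⇒o∸n≡m _ (identity z₃ v))))
  where
  bound : ∀ z v → suc ((z + v + v) * 2) + z * 2 ≡ suc ((z + v) * 4)
  bound = ℕ-Solver.solve-∀
  identity : ∀ z v → (z + v) * 8 + 3 + ((z + v) + ((z + v) + ((z + v) + z))) + (z + v + v) ≡ (z + v) * 13 + 3
  identity = ℕ-Solver.solve-∀
...       | no z₃≰m with g , refl ← m≤n⇒∃[o]m+o≡n (≰⇒> z₃≰m) = ⊥-elim (<⇒≱ (m+n≡o⇒m≤o g (beyond m g)) hi)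
  where
  beyond : ∀ m g → suc (3 * suc (m * 4)) + g ≡ m * 8 + 3 + (m + (m + (m + suc (m + g))))
  beyond = ℕ-Solver.solve-∀

8m+3≰x⇒8m+3≤16m+5∸x : ∀ m {x} → ¬ m * 8 + 3 ≤ x → m * 8 + 3 ≤ m * 16 + 5 ∸ x
8m+3≰x⇒8m+3≤16m+5∸x m {x} 8m+3≰x =
  ≤-trans (≤-reflexive (sym (m+n≡o⇒o∸n≡m (m * 8 + 2) (identity m))))
          (∸-monoʳ-≤ (m * 16 + 5) (≤-pred (subst (suc x ≤_) (+-suc (m * 8) 2) (≰⇒> 8m+3≰x))))
  where
  identity : ∀ m → m * 8 + 3 + (m * 8 + 2) ≡ m * 16 + 5
  identity = ℕ-Solver.solve-∀

LargeOrPaired-∸ : ∀ {m x} → 0 < m → x ≤ m * 16 + 5 → LargeOrPaired m (m * 16 + 5 ∸ x) → LargeOrPaired m x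
LargeOrPaired-∸ {m} {x} 0<m x≤K (j , j<n , found) =
  j , j<n , Sum.swap (Sum.map (λ eq → trans (cong (m * 16 + 5 ∸_) eq) (m∸[m∸n]≡n x≤K)) (∸-cancelˡ-≡ large≤K x≤K) found)
  where
  large≤K : large m j ≤ m * 16 + 5
  large≤K = ≤-trans (proj₂ (large-range 0<m j<n)) (3n≤16m+5 m)

large-onto : ∀ {m x} → 0 < m → InRange (suc (m * 4) + 1) (3 * suc (m * 4)) x → LargeOrPaired m x
large-onto {m} {x} 0<m x∈@(_ , x≤3n) with m * 8 + 3 ℕ.≤? x
... | yes 8m+3≤x = large-onto-upper {m} 8m+3≤x x≤3n
... | no 8m+3≰x  = LargeOrPaired-∸ 0<m (≤-trans x≤3n (3n≤16m+5 m))
  (large-onto-upper {m} (8m+3≰x⇒8m+3≤16m+5∸x m 8m+3≰x) (proj₂ (∸-range m x∈)))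

small-onto : ∀ {m x} → 0 < m → InRange 1 (suc (m * 4)) x → ∃[ j ] j < suc (m * 4) × small m j ≡± x
small-onto 0<m x∈ with j , p , refl ← smallAt-onto 0<m x∈ = j , Position⇒< p , small≡±smallAt p

module Cycle (m : ℕ) (0<m : 0 < m) where

  private
    n = suc (m * 4)

  open Modular n

  -- 2m + 1 is the inverse of 2 modulo n.
  J : ℕ → ℕ
  J k = (k * suc (m * 2)) % n

  J<n : ∀ k → J k < n
  J<n k = m%n<n (k * suc (m * 2)) n

  J-+2 : ∀ k → J ((k + 2) % n) ≡ suc (J k) % n
  J-+2 k = begin
    ((k + 2) % n * suc (m * 2)) % n  ≡⟨ [m%n*o]%n≡[m*o]%n (k + 2) (suc (m * 2)) ⟩
    ((k + 2) * suc (m * 2)) % n      ≡⟨ cong (_% n) (identity k m) ⟩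
    (suc (k * suc (m * 2)) + 1 * n) % n ≡⟨ [m+kn]%n≡m%n (suc (k * suc (m * 2))) 1 n ⟩
    suc (k * suc (m * 2)) % n        ≡⟨ [m+o%n]%n≡[m+o]%n 1 (k * suc (m * 2)) ⟨
    suc (J k) % n                    ∎
    where
    identity : ∀ k m → (k + 2) * suc (m * 2) ≡ suc (k * suc (m * 2)) + 1 * suc (m * 4)
    identity = ℕ-Solver.solve-∀

  J-*2 : ∀ j → j < n → J ((j * 2) % n) ≡ j
  J-*2 j j<n = begin
    ((j * 2) % n * suc (m * 2)) % n ≡⟨ [m%n*o]%n≡[m*o]%n (j * 2) (suc (m * 2)) ⟩
    (j * 2 * suc (m * 2)) % n       ≡⟨ cong (_% n) (identity j m) ⟩
    (j + j * n) % n                 ≡⟨ [m+kn]%n≡m%n j j n ⟩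
    j % n                           ≡⟨ m<n⇒m%n≡m j<n ⟩
    j                               ∎
    where
    identity : ∀ j m → j * 2 * suc (m * 2) ≡ j + j * suc (m * 4)
    identity = ℕ-Solver.solve-∀

  a b c : ℕ → ℤ
  a k = + large m (J k)
  b k = small m (J k)
  c k = + large m (suc (J k) % n) ℤ.- + (m * 16 + 5)

  large≤16m+5 : ∀ {j} → j < n → large m j ≤ m * 16 + 5
  large≤16m+5 j<n = ≤-trans (proj₂ (large-range 0<m j<n)) (3n≤16m+5 m)

  column-sum : ∀ k → a k ℤ.+ b k ℤ.+ c k ≡ 0ℤ
  column-sum k = cancel (+ large m (J k)) (+ large m (suc (J k) % n)) (+ (m * 16 + 5))
    where
    cancel : ∀ x y s → x ℤ.+ (s ℤ.- x ℤ.- y) ℤ.+ (y ℤ.- s) ≡ 0ℤ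
    cancel = ℤ-Solver.solve-∀

  row-sum : ∀ k → a ((k + 4) % n) ℤ.+ b ((k + 2) % n) ℤ.+ c k ≡ 0ℤ
  row-sum k = begin
    + u ℤ.+ small m (J ((k + 2) % n)) ℤ.+ (+ v ℤ.- + (m * 16 + 5))
      ≡⟨ cong (λ z → + u ℤ.+ z ℤ.+ (+ v ℤ.- + (m * 16 + 5))) small≡ ⟩
    + u ℤ.+ (+ (m * 16 + 5) ℤ.- + v ℤ.- + u) ℤ.+ (+ v ℤ.- + (m * 16 + 5))
      ≡⟨ cancel (+ u) (+ v) (+ (m * 16 + 5)) ⟩
    0ℤ ∎
    where
    u = large m (J ((k + 4) % n))
    v = large m (suc (J k) % n)
    small≡ : small m (J ((k + 2) % n)) ≡ + (m * 16 + 5) ℤ.- + v ℤ.- + u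
    small≡ = cong₂ (λ i i′ → + (m * 16 + 5) ℤ.- + large m i ℤ.- + large m i′) (J-+2 k) (begin
      suc (J ((k + 2) % n)) % n   ≡⟨ J-+2 ((k + 2) % n) ⟨
      J (((k + 2) % n + 2) % n)   ≡⟨ cong J ([m%n+o]%n≡[m+o]%n (k + 2) 2) ⟩
      J ((k + 2 + 2) % n)         ≡⟨ cong (λ i → J (i % n)) (+-assoc k 2 2) ⟩
      J ((k + 4) % n)             ∎)
    cancel : ∀ x y s → x ℤ.+ (s ℤ.- y ℤ.- x) ℤ.+ (y ℤ.- s) ≡ 0ℤ
    cancel = ℤ-Solver.solve-∀

  b-range : ∀ k → InRange 1 n ∣ b k ∣
  b-range k = let p = position 0<m (J<n k) in
    subst (InRange 1 n) (sym (∣≡±∣ (small≡±smallAt p))) (smallAt-range p)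

  c-negative : ∀ k → ∃[ p ] c k ≡ - + p × InRange (n + 1) (3 * n) p
  c-negative k = m * 16 + 5 ∸ large m j′ , p≤k⇒p-k≡-[k∸p] (large≤16m+5 j′<n) , ∸-range m (large-range 0<m j′<n)
    where
    j′ = suc (J k) % n
    j′<n = m%n<n (suc (J k)) n

  b-onto : ∀ x → InRange 1 n x → ∃[ k ] k < n × b k ≡± x
  b-onto x x∈ = let (j , j<n , small≡±x) = small-onto 0<m x∈ in
    (j * 2) % n , m%n<n (j * 2) n , subst (λ i → small m i ≡± x) (sym (J-*2 j j<n)) small≡±x

  ac-onto : ∀ x → InRange (n + 1) (3 * n) x → ∃[ k ] k < n × (a k ≡ + x ⊎ c k ≡ - + x)
  ac-onto x x∈ with large-onto 0<m x∈
  ... | j , j<n , inj₁ large≡x =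
    (j * 2) % n , m%n<n (j * 2) n , inj₁ (cong +_ (trans (cong (large m) (J-*2 j j<n)) large≡x))
  ... | j , j<n , inj₂ 16m+5∸large≡x = (i * 2) % n , m%n<n (i * 2) n , inj₂ (begin
    + large m (suc (J ((i * 2) % n)) % n) ℤ.- + (m * 16 + 5)
      ≡⟨ cong (λ i′ → + large m (suc i′ % n) ℤ.- + (m * 16 + 5)) (J-*2 i (m%n<n (j + pred n) n)) ⟩
    + large m (suc i % n) ℤ.- + (m * 16 + 5)
      ≡⟨ cong (λ j′ → + large m j′ ℤ.- + (m * 16 + 5)) ([1+[m+n∸1]%n]%n≡m j j<n) ⟩
    + large m j ℤ.- + (m * 16 + 5)
      ≡⟨ p≤k⇒p-k≡-[k∸p] (large≤16m+5 j<n) ⟩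
    - + (m * 16 + 5 ∸ large m j)
      ≡⟨ cong (λ y → - + y) 16m+5∸large≡x ⟩
    - + x ∎)
    where
    i = (j + pred n) % n

  cycleEntries : DiagonalEntries n
  cycleEntries = record
    { a          = a
    ; b          = b
    ; c          = c
    ; column-sum = λ k _ → column-sum k
    ; row-sum    = λ k _ → row-sum k
    ; b-range    = λ k _ → b-range k
    ; a-positive = λ k _ → large m (J k) , refl , large-range 0<m (J<n k)
    ; c-negative = λ k _ → c-negative k
    ; b-onto     = b-onto
    ; ac-onto    = ac-onto
    }

heffter-4m+1 : ∀ n m → n ≡ suc (m * 4) → .{{_ : NonZero n}} → 4 < n → (β : ℕ) →
  Σ (Array n) (λ L → Heffter n 3 L × Props n β L × Heffter n 3 (shift L) × Props n β (shift L))
heffter-4m+1 _ zero    refl (s≤s ()) β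
heffter-4m+1 _ (suc m) refl 4<n β = diagonalArray 4<n β E , diagonalArray-heffter 4<n β E
  where E = Cycle.cycleEntries (suc m) (s≤s z≤n)

theorem4p2 : (n : ℕ) .{{_ : NonZero n}} → n % 4 ≡ 1 →
    (β : ℕ) → β + 5 ≤ n →
    Σ (Array n) (λ L →
      Heffter n 3 L × Props n β L
      × Heffter n 3 (shift L) × Props n β (shift L))
theorem4p2 n n%4≡1 β β+5≤n = heffter-4m+1 n (n / 4) n≡4m+1 (≤-trans (m≤n+m 5 β) β+5≤n) β
  where
  n≡4m+1 : n ≡ suc (n / 4 * 4)
  n≡4m+1 = trans (m≡m%n+[m/n]*n n 4) (cong (_+ n / 4 * 4) n%4≡1)
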